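{- Let $\gamma$ be an umbra and $x,y$ indeterminates. Then for every $n\ge0$, $$(x+y)^n\simeq\sum_{k=0}^{n}\binom{n}{k}\,y\,\big(y-k.\gamma\big)^{k-1}\,\big(x+k.\gamma\big)^{n-k},$$ where $y-k.\gamma$ denotes $y+(-k).\gamma$ with $(-k).\gamma$ the dot-product of the integer $-k$ with $\gamma$ (g.f. $f(\gamma,t)^{ -k}$), $k.\gamma$ has g.f. $f(\gamma,t)^k$, the umbrae $(-k).\gamma$ and $k.\gamma$ are uncorrelated, and the factor $y(y-k.\gamma)^{k-1}$ is read as $1$ for $k=0$.
   Context: Classical umbral calculus: umbrae are symbols with a linear evaluation $E$ ($E[1]=1$, $E[\alpha^i\beta^j\cdots]=E[\alpha^i]E[\beta^j]\cdots$ for pairwise distinct umbrae), over a commutative integral domain $R$ whose quotient field has characteristic $0$, with polynomial rings such as $R[x,y]$ allowed as scalars. An umbra $\alpha$ has moments $E[\alpha^n]$ and g.f. $f(\alpha,t)=\sum_nE[\alpha^n]t^n/n!$; $p\simeq q$ means $E[p]=E[q]$. For an integer $c$, the dot-product $c.\alpha$ is an (auxiliary) umbra with g.f. $f(\alpha,t)^c$. Umbral polynomials such as $y(y+(-k).\gamma)^{k-1}(x+k.\gamma)^{n-k}$ are expanded and evaluated by $E$ coefficientwise in $x,y$. -}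

module Defs where

open import Level using (_⊔_)
open import Data.Nat using (ℕ; zero; suc; _∸_)
open import Data.Nat.Combinatorics using (_C_)
open import Data.Integer using (ℤ; +_; -[1+_])
open import Data.Sum using (_⊎_)
open import Relation.Nullary using (¬_)
open import Algebra.Bundles using (CommutativeRing)

module Umbral {c ℓ} (R : CommutativeRing c ℓ) where
  open CommutativeRing R

  fromℕ : ℕ → Carrier
  fromℕ zero    = 0#
  fromℕ (suc n) = 1# + fromℕ n

  infixr 8 _^ᴿ_
  _^ᴿ_ : Carrier → ℕ → Carrier
  x ^ᴿ zero  = 1#
  x ^ᴿ suc n = x * (x ^ᴿ n)

  ∑≤ : ℕ → (ℕ → Carrier) → Carrier
  ∑≤ zero    f = f 0
  ∑≤ (suc n) f = ∑≤ n f + f (suc n)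

  record IsChar0Domain : Set (c ⊔ ℓ) where
    field
      nontrivial : ¬ (1# ≈ 0#)
      noZeroDivisors : ∀ a b → a * b ≈ 0# → (a ≈ 0#) ⊎ (b ≈ 0#)
      char0 : ∀ n → ¬ (fromℕ (suc n) ≈ 0#)

  -- moment sequences (coefficients of exponential generating functions)
  Seq : Set c
  Seq = ℕ → Carrier

  -- moments of the unity umbra (g.f. 1)
  δ : Seq
  δ zero    = 1#
  δ (suc _) = 0#

  -- product of exponential generating functions
  conv : Seq → Seq → Seq
  conv a b n = ∑≤ n (λ i → fromℕ (n C i) * (a i * b (n ∸ i)))

  powS : Seq → ℕ → Seq
  powS a zero    = δ
  powS a (suc k) = conv (powS a k) a

  -- reciprocal of an e.g.f. with constant term 1:
  -- 1/f = Σ_m (-1)^m (f - 1)^m  (finite in each coefficient)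
  invS : Seq → Seq
  invS a n = ∑≤ n (λ m → ((- 1#) ^ᴿ m) * powS (λ i → a i - δ i) m n)

  -- an umbra, given by its moments E[α^n]; E[α^0] = E[1] = 1
  record Umbra : Set (c ⊔ ℓ) where
    field
      moment   : Seq
      moment-0 : moment 0 ≈ 1#
  open Umbra public

  -- moments of the dot-product c.γ (g.f. f(γ,t)^c) for an integer c
  dotMoments : ℤ → Umbra → Seq
  dotMoments (+ k)     γ = powS (moment γ) k
  dotMoments -[1+ k ]  γ = powS (invS (moment γ)) (suc k)

  -- E[(z + α)^m] for a scalar z and an umbra α with moments s:
  -- expand binomially and evaluate coefficientwise
  evalShift : Seq → Carrier → ℕ → Carrier
  evalShift s z m = ∑≤ m (λ i → fromℕ (m C i) * ((z ^ᴿ (m ∸ i)) * s i))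

  -- E[ y (y + (-k).γ)^(k-1) ], read as 1 for k = 0
  yFactor : Umbra → Carrier → ℕ → Carrier
  yFactor γ y zero      = 1#
  yFactor γ y (suc k′)  = y * evalShift (dotMoments (Data.Integer.- (+ suc k′)) γ) y k′

  -- E[ C(n,k) y (y-k.γ)^(k-1) (x+k.γ)^(n-k) ]; since (-k).γ and k.γ are
  -- uncorrelated, the evaluation factorizes.
  term : Umbra → Carrier → Carrier → ℕ → ℕ → Carrier
  term γ x y n k =
    fromℕ (n C k) * (yFactor γ y k * evalShift (dotMoments (+ k) γ) x (n ∸ k))

  rhs : Umbra → Carrier → Carrier → ℕ → Carrier
  rhs γ x y n = ∑≤ n (term γ x y n)

-- Read moment sequences as exponential generating functions and let f = f(γ,t).
-- Then term k of the right-hand side is n![tⁿ] P k · (t f)ᵏ/k! · e^{xt}, where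
-- P k = E[y (y − k.γ)^{k−1}], so the identity is the binomial theorem
-- e^{yt} e^{xt} = e^{(x+y)t} combined with the Lagrange expansion
--   e^{yt} = Σₖ P k · (t f)ᵏ/k!.
-- The expansion is proved with the functional L(g)ₙ = n![tⁿ] g · (t f)′ · f^{−n−1}.
-- It sends (t f)ᵏ/k! to the indicator of k (the residue of u^{k−n−1} u′ for
-- u = t f vanishes unless k = n), it is unitriangular, hence injective, and it
-- sends e^{yt} to P.
module Submission where

open import Defs
open import Data.Nat as ℕ using (ℕ; zero; suc; _≤_; _<_; z≤n; s≤s; _∸_)
import Data.Nat.Properties as ℕ
open import Data.Nat.Combinatorics using (_C_; nCn≡1; nC1≡n; k>n⇒nCk≡0; nCk+nC[k+1]≡[n+1]C[k+1])
open import Data.Sum using (inj₁; inj₂)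
open import Data.Empty using (⊥-elim)
open import Relation.Binary.PropositionalEquality as ≡ using (_≡_; _≢_)
open import Relation.Nullary using (Dec; yes; no)
open import Data.Nat.Induction using (<-rec)
open import Algebra.Bundles using (CommutativeRing)

module Sums {c ℓ} (R : CommutativeRing c ℓ) where
  open CommutativeRing R hiding (zero)
  open Umbral R using (∑≤)
  open import Algebra.Properties.Ring ring using (-‿+-comm)
  open import Algebra.Properties.CommutativeSemigroup +-commutativeSemigroup using (interchange)

  ∑-cong : ∀ n {f g : ℕ → Carrier} → (∀ i → i ≤ n → f i ≈ g i) → ∑≤ n f ≈ ∑≤ n g
  ∑-cong zero    f≈g = f≈g 0 z≤n
  ∑-cong (suc n) f≈g = +-cong (∑-cong n (λ i i≤n → f≈g i (ℕ.m≤n⇒m≤1+n i≤n))) (f≈g (suc n) ℕ.≤-refl)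

  ∑-distrib-+ : ∀ n (f g : ℕ → Carrier) → ∑≤ n (λ i → f i + g i) ≈ ∑≤ n f + ∑≤ n g
  ∑-distrib-+ zero    f g = refl
  ∑-distrib-+ (suc n) f g = trans (+-congʳ (∑-distrib-+ n f g)) (interchange _ _ _ _)

  ∑-neg : ∀ n (f : ℕ → Carrier) → ∑≤ n (λ i → - f i) ≈ - ∑≤ n f
  ∑-neg zero    f = refl
  ∑-neg (suc n) f = trans (+-congʳ (∑-neg n f)) (-‿+-comm _ _)

  *-distribˡ-∑ : ∀ n a (f : ℕ → Carrier) → a * ∑≤ n f ≈ ∑≤ n (λ i → a * f i)
  *-distribˡ-∑ zero    a f = refl
  *-distribˡ-∑ (suc n) a f = trans (distribˡ a _ _) (+-congʳ (*-distribˡ-∑ n a f))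

  *-distribʳ-∑ : ∀ n a (f : ℕ → Carrier) → ∑≤ n f * a ≈ ∑≤ n (λ i → f i * a)
  *-distribʳ-∑ zero    a f = refl
  *-distribʳ-∑ (suc n) a f = trans (distribʳ a _ _) (+-congʳ (*-distribʳ-∑ n a f))

  ∑-zero : ∀ n {f : ℕ → Carrier} → (∀ i → i ≤ n → f i ≈ 0#) → ∑≤ n f ≈ 0#
  ∑-zero n f≈0 = trans (∑-cong n f≈0) (zeros n)
    where
    zeros : ∀ n → ∑≤ n (λ _ → 0#) ≈ 0#
    zeros zero    = refl
    zeros (suc n) = trans (+-congʳ (zeros n)) (+-identityˡ 0#)

  ∑-unfoldˡ : ∀ n (f : ℕ → Carrier) → ∑≤ (suc n) f ≈ f 0 + ∑≤ n (λ i → f (suc i))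
  ∑-unfoldˡ zero    f = refl
  ∑-unfoldˡ (suc n) f = trans (+-congʳ (∑-unfoldˡ n f)) (+-assoc _ _ _)

  ∑-truncate : ∀ m n {f : ℕ → Carrier} → m ≤ n → (∀ i → m < i → i ≤ n → f i ≈ 0#) → ∑≤ n f ≈ ∑≤ m f
  ∑-truncate m zero    z≤n _   = refl
  ∑-truncate m (suc n) m≤ f≈0 with ℕ.m≤n⇒m<n∨m≡n m≤
  ... | inj₁ (s≤s m≤n) = trans (+-cong (∑-truncate m n m≤n (λ i m<i i≤n → f≈0 i m<i (ℕ.m≤n⇒m≤1+n i≤n)))
                                       (f≈0 (suc n) (s≤s m≤n) ℕ.≤-refl))
                               (+-identityʳ _)
  ... | inj₂ ≡.refl = refl

  ∑-single : ∀ n k {f : ℕ → Carrier} → k ≤ n → (∀ i → i ≤ n → i ≢ k → f i ≈ 0#) → ∑≤ n f ≈ f k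
  ∑-single n zero    {f} _ f≈0 = ∑-truncate 0 n z≤n (λ i 0<i i≤n → f≈0 i i≤n (ℕ.n>0⇒n≢0 0<i))
  ∑-single n (suc k) {f} k<n f≈0 = begin
    ∑≤ n f             ≈⟨ ∑-truncate (suc k) n k<n (λ i k<i i≤n → f≈0 i i≤n (ℕ.>⇒≢ k<i)) ⟩
    ∑≤ k f + f (suc k)
      ≈⟨ +-congʳ (∑-zero k (λ i i≤k → f≈0 i (ℕ.≤-trans (ℕ.m≤n⇒m≤1+n i≤k) k<n) (ℕ.<⇒≢ (s≤s i≤k)))) ⟩
    0# + f (suc k)     ≈⟨ +-identityˡ _ ⟩
    f (suc k)          ∎
    where open import Relation.Binary.Reasoning.Setoid setoid

  ∑-comm : ∀ m n (g : ℕ → ℕ → Carrier) → ∑≤ m (λ i → ∑≤ n (g i)) ≈ ∑≤ n (λ k → ∑≤ m (λ i → g i k))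
  ∑-comm m zero    g = refl
  ∑-comm m (suc n) g = trans (∑-distrib-+ m (λ i → ∑≤ n (g i)) (λ i → g i (suc n))) (+-congʳ (∑-comm m n g))

-- A sequence s stands for the exponential generating function Σₙ s n tⁿ/n!;
-- conv is then the product, and ∂ (the shift) the derivative.
module PowerSeries {c ℓ} (R : CommutativeRing c ℓ) where
  open CommutativeRing R hiding (zero)
  open Umbral R
  open Sums R
  open import Relation.Binary.Reasoning.Setoid setoid
  open import Algebra.Properties.Ring ring using (-‿distribˡ-*; -‿distribʳ-*)
  open import Algebra.Properties.CommutativeSemigroup +-commutativeSemigroup
    using () renaming (x∙yz≈y∙xz to +-leftComm)
  open import Algebra.Properties.CommutativeSemigroup *-commutativeSemigroup
    using () renaming (x∙yz≈y∙xz to *-leftComm)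

  fromℕ-+ : ∀ m n → fromℕ (m ℕ.+ n) ≈ fromℕ m + fromℕ n
  fromℕ-+ zero    n = sym (+-identityˡ _)
  fromℕ-+ (suc m) n = trans (+-congˡ (fromℕ-+ m n)) (sym (+-assoc _ _ _))

  fromℕ-1 : fromℕ 1 ≈ 1#
  fromℕ-1 = +-identityʳ 1#

  fromℕ-pascal : ∀ n i → fromℕ (suc n C suc i) ≈ fromℕ (n C i) + fromℕ (n C suc i)
  fromℕ-pascal n i = trans (reflexive (≡.cong fromℕ (≡.sym (nCk+nC[k+1]≡[n+1]C[k+1] n i))))
                           (fromℕ-+ (n C i) (n C suc i))

  fromℕ-C-zero : ∀ {n k} → n < k → ∀ x → fromℕ (n C k) * x ≈ 0#
  fromℕ-C-zero n<k x = trans (*-congʳ (reflexive (≡.cong fromℕ (k>n⇒nCk≡0 n<k)))) (zeroˡ x)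

  infix 4 _≋_
  _≋_ : Seq → Seq → Set ℓ
  s ≋ t = ∀ n → s n ≈ t n

  ∂ : Seq → Seq
  ∂ s n = s (suc n)

  _+ˢ_ : Seq → Seq → Seq
  (s +ˢ t) n = s n + t n

  _·ˢ_ : Carrier → Seq → Seq
  (a ·ˢ s) n = a * s n

  -ˢ_ : Seq → Seq
  (-ˢ s) n = - s n

  conv-cong-≤ : ∀ n {f f′ g g′} → (∀ i → i ≤ n → f i ≈ f′ i) → (∀ i → i ≤ n → g i ≈ g′ i) →
                conv f g n ≈ conv f′ g′ n
  conv-cong-≤ n f≈ g≈ = ∑-cong n (λ i i≤n → *-congˡ (*-cong (f≈ i i≤n) (g≈ (n ∸ i) (ℕ.m∸n≤m n i))))

  conv-congˡ : ∀ {f f′} g → f ≋ f′ → conv f g ≋ conv f′ g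
  conv-congˡ g f≈ n = conv-cong-≤ n {g = g} (λ i _ → f≈ i) (λ _ _ → refl)

  conv-congʳ : ∀ f {g g′} → g ≋ g′ → conv f g ≋ conv f g′
  conv-congʳ f g≈ n = conv-cong-≤ n {f = f} (λ _ _ → refl) (λ i _ → g≈ i)

  conv-at-0 : ∀ f g → conv f g 0 ≈ f 0 * g 0
  conv-at-0 f g = trans (*-congʳ fromℕ-1) (*-identityˡ _)

  conv-distribʳ : ∀ f g h → conv (f +ˢ g) h ≋ conv f h +ˢ conv g h
  conv-distribʳ f g h n =
    trans (∑-cong n (λ i _ → trans (*-congˡ (distribʳ _ _ _)) (distribˡ _ _ _))) (∑-distrib-+ n _ _)

  conv-scaleˡ : ∀ a f g → conv (a ·ˢ f) g ≋ a ·ˢ conv f g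
  conv-scaleˡ a f g n =
    trans (∑-cong n (λ i _ → trans (*-congˡ (*-assoc _ _ _)) (*-leftComm _ _ _))) (sym (*-distribˡ-∑ n a _))

  conv-negˡ : ∀ f g → conv (-ˢ f) g ≋ -ˢ conv f g
  conv-negˡ f g n =
    trans (∑-cong n (λ i _ → trans (*-congˡ (sym (-‿distribˡ-* _ _))) (sym (-‿distribʳ-* _ _)))) (∑-neg n _)

  conv-zeroʳ : ∀ f {g} → g ≋ (λ _ → 0#) → conv f g ≋ (λ _ → 0#)
  conv-zeroʳ f g≈0 n = ∑-zero n (λ i _ → trans (*-congˡ (trans (*-congˡ (g≈0 (n ∸ i))) (zeroʳ _))) (zeroʳ _))

  ∂-conv : ∀ f g → ∂ (conv f g) ≋ conv (∂ f) g +ˢ conv f (∂ g)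
  ∂-conv f g n = begin
    conv f g (suc n)                    ≈⟨ ∑-unfoldˡ n _ ⟩
    first + ∑≤ n (λ i → fromℕ (suc n C suc i) * X i)
      ≈⟨ +-congˡ (trans (∑-cong n (λ i _ → trans (*-congʳ (fromℕ-pascal n i)) (distribʳ (X i) _ _)))
                        (∑-distrib-+ n _ _)) ⟩
    first + (conv (∂ f) g n + rest)     ≈⟨ +-leftComm _ _ _ ⟩
    conv (∂ f) g n + (first + rest)     ≈⟨ +-congˡ (sym split) ⟩
    conv (∂ f) g n + conv f (∂ g) n     ∎
    where
    X : ℕ → Carrier
    X i = f (suc i) * g (n ∸ i)
    first rest : Carrier
    first = fromℕ (n C 0) * (f 0 * g (suc n))
    rest  = ∑≤ n (λ i → fromℕ (n C suc i) * X i)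
    split : conv f (∂ g) n ≈ first + rest
    split = begin
      conv f (∂ g) n
        ≈⟨ ∑-cong n (λ i i≤n → *-congˡ (*-congˡ (reflexive (≡.cong g (≡.sym (ℕ.+-∸-assoc 1 i≤n)))))) ⟩
      ∑≤ n (λ i → fromℕ (n C i) * (f i * g (suc n ∸ i)))
        ≈⟨ sym (∑-truncate n (suc n) (ℕ.n≤1+n n) (λ i n<i _ → fromℕ-C-zero n<i _)) ⟩
      ∑≤ (suc n) (λ i → fromℕ (n C i) * (f i * g (suc n ∸ i))) ≈⟨ ∑-unfoldˡ n _ ⟩
      first + rest ∎

  conv-comm : ∀ f g → conv f g ≋ conv g f
  conv-comm f g zero    = trans (conv-at-0 f g) (trans (*-comm _ _) (sym (conv-at-0 g f)))
  conv-comm f g (suc n) = begin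
    conv f g (suc n)                ≈⟨ ∂-conv f g n ⟩
    conv (∂ f) g n + conv f (∂ g) n ≈⟨ +-cong (conv-comm (∂ f) g n) (conv-comm f (∂ g) n) ⟩
    conv g (∂ f) n + conv (∂ g) f n ≈⟨ +-comm _ _ ⟩
    conv (∂ g) f n + conv g (∂ f) n ≈⟨ sym (∂-conv g f n) ⟩
    conv g f (suc n)                ∎

  conv-distribˡ : ∀ f g h → conv f (g +ˢ h) ≋ conv f g +ˢ conv f h
  conv-distribˡ f g h n =
    trans (conv-comm f (g +ˢ h) n) (trans (conv-distribʳ g h f n) (+-cong (conv-comm g f n) (conv-comm h f n)))

  conv-scaleʳ : ∀ a f g → conv f (a ·ˢ g) ≋ a ·ˢ conv f g
  conv-scaleʳ a f g n = trans (conv-comm f (a ·ˢ g) n) (trans (conv-scaleˡ a g f n) (*-congˡ (conv-comm g f n)))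

  conv-negʳ : ∀ f g → conv f (-ˢ g) ≋ -ˢ conv f g
  conv-negʳ f g n = trans (conv-comm f (-ˢ g) n) (trans (conv-negˡ g f n) (-‿cong (conv-comm g f n)))

  conv-assoc : ∀ f g h → conv (conv f g) h ≋ conv f (conv g h)
  conv-assoc f g h zero = begin
    conv (conv f g) h 0 ≈⟨ trans (conv-at-0 (conv f g) h) (*-congʳ (conv-at-0 f g)) ⟩
    (f 0 * g 0) * h 0   ≈⟨ *-assoc _ _ _ ⟩
    f 0 * (g 0 * h 0)   ≈⟨ sym (trans (conv-at-0 f (conv g h)) (*-congˡ (conv-at-0 g h))) ⟩
    conv f (conv g h) 0 ∎
  conv-assoc f g h (suc n) = begin
    conv (conv f g) h (suc n)
      ≈⟨ ∂-conv (conv f g) h n ⟩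
    conv (∂ (conv f g)) h n + conv (conv f g) (∂ h) n
      ≈⟨ +-congʳ (trans (conv-congˡ h (∂-conv f g) n) (conv-distribʳ (conv (∂ f) g) (conv f (∂ g)) h n)) ⟩
    (conv (conv (∂ f) g) h n + conv (conv f (∂ g)) h n) + conv (conv f g) (∂ h) n
      ≈⟨ +-cong (+-cong (conv-assoc (∂ f) g h n) (conv-assoc f (∂ g) h n)) (conv-assoc f g (∂ h) n) ⟩
    (conv (∂ f) (conv g h) n + conv f (conv (∂ g) h) n) + conv f (conv g (∂ h)) n
      ≈⟨ +-assoc _ _ _ ⟩
    conv (∂ f) (conv g h) n + (conv f (conv (∂ g) h) n + conv f (conv g (∂ h)) n)
      ≈⟨ +-congˡ (sym (trans (conv-congʳ f (∂-conv g h) n) (conv-distribˡ f (conv (∂ g) h) (conv g (∂ h)) n))) ⟩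
    conv (∂ f) (conv g h) n + conv f (∂ (conv g h)) n
      ≈⟨ sym (∂-conv f (conv g h) n) ⟩
    conv f (conv g h) (suc n) ∎

  conv-leftComm : ∀ f g h → conv f (conv g h) ≋ conv g (conv f h)
  conv-leftComm f g h n = begin
    conv f (conv g h) n ≈⟨ sym (conv-assoc f g h n) ⟩
    conv (conv f g) h n ≈⟨ conv-congˡ h (conv-comm f g) n ⟩
    conv (conv g f) h n ≈⟨ conv-assoc g f h n ⟩
    conv g (conv f h) n ∎

  conv-identityʳ : ∀ f → conv f δ ≋ f
  conv-identityʳ f zero    = trans (conv-at-0 f δ) (*-identityʳ _)
  conv-identityʳ f (suc n) = begin
    conv f δ (suc n)                ≈⟨ ∂-conv f δ n ⟩
    conv (∂ f) δ n + conv f (∂ δ) n ≈⟨ +-cong (conv-identityʳ (∂ f) n) (conv-zeroʳ f (λ _ → refl) n) ⟩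
    f (suc n) + 0#                  ≈⟨ +-identityʳ _ ⟩
    f (suc n)                       ∎

  conv-identityˡ : ∀ f → conv δ f ≋ f
  conv-identityˡ f n = trans (conv-comm δ f n) (conv-identityʳ f n)

  conv-vanishes-below : ∀ p q f g → (∀ i → i < p → f i ≈ 0#) → (∀ i → i < q → g i ≈ 0#) →
                        ∀ n → n < p ℕ.+ q → conv f g n ≈ 0#
  conv-vanishes-below p q f g f≈0 g≈0 n n<p+q = ∑-zero n summand≈0
    where
    summand≈0 : ∀ i → i ≤ n → fromℕ (n C i) * (f i * g (n ∸ i)) ≈ 0#
    summand≈0 i i≤n with i ℕ.<? p
    ... | yes i<p = trans (*-congˡ (trans (*-congʳ (f≈0 i i<p)) (zeroˡ _))) (zeroʳ _)
    ... | no  i≮p = trans (*-congˡ (trans (*-congˡ (g≈0 (n ∸ i) n∸i<q)) (zeroʳ _))) (zeroʳ _)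
      where
      n∸i<q : n ∸ i < q
      n∸i<q = ℕ.+-cancelˡ-< i (n ∸ i) q (ℕ.<-≤-trans (≡.subst (_< p ℕ.+ q) (≡.sym (ℕ.m+[n∸m]≡n i≤n)) n<p+q)
                                          (ℕ.+-monoˡ-≤ q (ℕ.≮⇒≥ i≮p)))

  powS-at-0 : ∀ s k → s 0 ≈ 1# → powS s k 0 ≈ 1#
  powS-at-0 s zero    s0≈1 = refl
  powS-at-0 s (suc k) s0≈1 = trans (conv-at-0 (powS s k) s) (trans (*-cong (powS-at-0 s k s0≈1) s0≈1) (*-identityˡ 1#))

  -- the series tᵏ/k!
  monomial : ℕ → Seq
  monomial zero          = δ
  monomial (suc k) zero    = 0#
  monomial (suc k) (suc n) = monomial k n

  monomial-diag : ∀ k → monomial k k ≈ 1#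
  monomial-diag zero    = refl
  monomial-diag (suc k) = monomial-diag k

  monomial-offDiag : ∀ k i → i ≢ k → monomial k i ≈ 0#
  monomial-offDiag zero    zero    i≢k = ⊥-elim (i≢k ≡.refl)
  monomial-offDiag zero    (suc i) i≢k = refl
  monomial-offDiag (suc k) zero    i≢k = refl
  monomial-offDiag (suc k) (suc i) i≢k = monomial-offDiag k i (λ i≡k → i≢k (≡.cong suc i≡k))

  conv-monomial : ∀ k s n → conv (monomial k) s n ≈ fromℕ (n C k) * s (n ∸ k)
  conv-monomial k s n = split (k ℕ.≤? n)
    where
    off : ∀ i → i ≢ k → fromℕ (n C i) * (monomial k i * s (n ∸ i)) ≈ 0#
    off i i≢k = trans (*-congˡ (trans (*-congʳ (monomial-offDiag k i i≢k)) (zeroˡ _))) (zeroʳ _)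
    split : Dec (k ≤ n) → conv (monomial k) s n ≈ fromℕ (n C k) * s (n ∸ k)
    split (yes k≤n) = trans (∑-single n k k≤n (λ i _ → off i))
                           (*-congˡ (trans (*-congʳ (monomial-diag k)) (*-identityˡ _)))
    split (no k≰n)  = trans (∑-zero n (λ i i≤n → off i (λ i≡k → k≰n (≡.subst (_≤ n) i≡k i≤n))))
                           (sym (fromℕ-C-zero (ℕ.≰⇒> k≰n) _))

  exp : Carrier → Seq
  exp z n = z ^ᴿ n

  evalShift≈conv-exp : ∀ s z m → evalShift s z m ≈ conv (exp z) s m
  evalShift≈conv-exp s z m = trans (∑-cong m (λ i _ → *-congˡ (*-comm _ _))) (conv-comm s (exp z) m)

  conv-exp-exp : ∀ x y n → conv (exp y) (exp x) n ≈ (x + y) ^ᴿ n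
  conv-exp-exp x y zero    = trans (conv-at-0 (exp y) (exp x)) (*-identityˡ 1#)
  conv-exp-exp x y (suc n) = begin
    conv (exp y) (exp x) (suc n)                        ≈⟨ ∂-conv (exp y) (exp x) n ⟩
    conv (y ·ˢ exp y) (exp x) n + conv (exp y) (x ·ˢ exp x) n
      ≈⟨ +-cong (conv-scaleˡ y (exp y) (exp x) n) (conv-scaleʳ x (exp y) (exp x) n) ⟩
    y * conv (exp y) (exp x) n + x * conv (exp y) (exp x) n ≈⟨ sym (distribʳ _ y x) ⟩
    (y + x) * conv (exp y) (exp x) n                    ≈⟨ *-cong (+-comm y x) (conv-exp-exp x y n) ⟩
    (x + y) ^ᴿ suc n                                    ∎

module Reciprocal {c ℓ} (R : CommutativeRing c ℓ) where
  open CommutativeRing R hiding (zero)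
  open Umbral R
  open Sums R
  open PowerSeries R
  open import Relation.Binary.Reasoning.Setoid setoid
  open import Algebra.Properties.Ring ring using (-1*x≈-x)
  open import Algebra.Properties.CommutativeSemigroup +-commutativeSemigroup
    using () renaming (x∙yz≈y∙xz to +-leftComm)
  open import Algebra.Properties.CommutativeSemigroup *-commutativeSemigroup
    using () renaming (x∙yz≈y∙xz to *-leftComm)

  -- The series 1/f = Σₘ (−1)ᵐ (f − 1)ᵐ is a finite sum in each coefficient because f − 1
  -- has no constant term; this yields the recursion 1/f = 1 − (f − 1)/f.
  invS-inverse : ∀ a → a 0 ≈ 1# → conv a (invS a) ≋ δ
  invS-inverse a a0≈1 n = begin
    conv a b n                          ≈⟨ conv-congˡ b a≈d+δ n ⟩
    conv (d +ˢ δ) b n                   ≈⟨ conv-distribʳ d δ b n ⟩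
    conv d b n + conv δ b n             ≈⟨ +-congˡ (trans (conv-identityˡ b n) (b-recursion n)) ⟩
    conv d b n + (δ n + - conv d b n)   ≈⟨ +-leftComm _ _ _ ⟩
    δ n + (conv d b n + - conv d b n)   ≈⟨ trans (+-congˡ (-‿inverseʳ _)) (+-identityʳ _) ⟩
    δ n                                 ∎
    where
    d b : Seq
    d i = a i - δ i
    b = invS a

    sign : ℕ → Carrier
    sign m = (- 1#) ^ᴿ m

    a≈d+δ : a ≋ d +ˢ δ
    a≈d+δ i = sym (trans (+-assoc _ _ _) (trans (+-congˡ (-‿inverseˡ _)) (+-identityʳ _)))

    powS-d-vanishes : ∀ m n → n < m → powS d m n ≈ 0#
    powS-d-vanishes (suc m) n n<1+m =
      conv-vanishes-below m 1 (powS d m) d (powS-d-vanishes m) d-vanishes n (≡.subst (n <_) (ℕ.+-comm 1 m) n<1+m)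
      where
      d-vanishes : ∀ i → i < 1 → d i ≈ 0#
      d-vanishes zero    _              = trans (+-congʳ a0≈1) (-‿inverseʳ 1#)
      d-vanishes (suc i) (s≤s ())

    b-as-longer-sum : ∀ n K → n ≤ K → b n ≈ ∑≤ K (λ m → sign m * powS d m n)
    b-as-longer-sum n K n≤K =
      sym (∑-truncate n K n≤K (λ m n<m _ → trans (*-congˡ (powS-d-vanishes m n n<m)) (zeroʳ _)))

    conv-d-b : ∀ n → conv d b n ≈ ∑≤ n (λ m → sign m * powS d (suc m) n)
    conv-d-b n = begin
      conv d b n
        ≈⟨ ∑-cong n (λ i i≤n → *-congˡ (*-congˡ (b-as-longer-sum (n ∸ i) n (ℕ.m∸n≤m n i)))) ⟩
      ∑≤ n (λ i → fromℕ (n C i) * (d i * ∑≤ n (λ m → sign m * powS d m (n ∸ i))))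
        ≈⟨ ∑-cong n (λ i _ → distribute i) ⟩
      ∑≤ n (λ i → ∑≤ n (λ m → sign m * (fromℕ (n C i) * (d i * powS d m (n ∸ i)))))
        ≈⟨ ∑-comm n n _ ⟩
      ∑≤ n (λ m → ∑≤ n (λ i → sign m * (fromℕ (n C i) * (d i * powS d m (n ∸ i)))))
        ≈⟨ ∑-cong n (λ m _ → trans (sym (*-distribˡ-∑ n (sign m) _)) (*-congˡ (conv-comm d (powS d m) n))) ⟩
      ∑≤ n (λ m → sign m * powS d (suc m) n) ∎
      where
      distribute : ∀ i → fromℕ (n C i) * (d i * ∑≤ n (λ m → sign m * powS d m (n ∸ i)))
                         ≈ ∑≤ n (λ m → sign m * (fromℕ (n C i) * (d i * powS d m (n ∸ i))))
      distribute i = trans (*-congˡ (*-distribˡ-∑ n (d i) _)) (trans (*-distribˡ-∑ n _ _)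
                       (∑-cong n (λ m _ → trans (*-congˡ (*-leftComm _ _ _)) (*-leftComm _ _ _))))

    b-recursion : ∀ n → b n ≈ δ n + - conv d b n
    b-recursion n = begin
      b n                                                    ≈⟨ b-as-longer-sum n (suc n) (ℕ.n≤1+n n) ⟩
      ∑≤ (suc n) (λ m → sign m * powS d m n)                 ≈⟨ ∑-unfoldˡ n _ ⟩
      1# * δ n + ∑≤ n (λ m → (- 1# * sign m) * powS d (suc m) n)
        ≈⟨ +-cong (*-identityˡ _) (∑-cong n (λ m _ → trans (*-assoc _ _ _) (-1*x≈-x _))) ⟩
      δ n + ∑≤ n (λ m → - (sign m * powS d (suc m) n))       ≈⟨ +-congˡ (∑-neg n _) ⟩
      δ n + - ∑≤ n (λ m → sign m * powS d (suc m) n)         ≈⟨ +-congˡ (-‿cong (sym (conv-d-b n))) ⟩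
      δ n + - conv d b n                                     ∎

module Lagrange {c ℓ} (R : CommutativeRing c ℓ) where
  open CommutativeRing R hiding (zero)
  open Umbral R
  open Sums R
  open PowerSeries R
  open Reciprocal R
  open import Relation.Binary.Reasoning.Setoid setoid
  open import Algebra.Properties.Ring ring using (-‿+-comm)
  open import Algebra.Properties.Group +-group using (∙-cancelˡ; inverseʳ-unique; ε⁻¹≈ε)
  open import Algebra.Properties.CommutativeSemigroup *-commutativeSemigroup
    using () renaming (x∙yz≈y∙xz to *-leftComm)

  module Expansion (f : Seq) (f0≈1 : f 0 ≈ 1#) where

    pow powInv : ℕ → Seq
    pow    = powS f
    powInv = powS (invS f)

    f⁻¹-inverse : conv f (invS f) ≋ δ
    f⁻¹-inverse = invS-inverse f f0≈1

    conv-pow-powInv : ∀ k j → conv (pow k) (powInv (k ℕ.+ j)) ≋ powInv j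
    conv-pow-powInv zero    j n = conv-identityˡ (powInv j) n
    conv-pow-powInv (suc k) j n = begin
      conv (conv (pow k) f) (conv (powInv (k ℕ.+ j)) (invS f)) n
        ≈⟨ conv-assoc (pow k) f (conv (powInv (k ℕ.+ j)) (invS f)) n ⟩
      conv (pow k) (conv f (conv (powInv (k ℕ.+ j)) (invS f))) n
        ≈⟨ conv-congʳ (pow k) cancel n ⟩
      conv (pow k) (powInv (k ℕ.+ j)) n
        ≈⟨ conv-pow-powInv k j n ⟩
      powInv j n ∎
      where
      cancel : conv f (conv (powInv (k ℕ.+ j)) (invS f)) ≋ powInv (k ℕ.+ j)
      cancel m = trans (conv-leftComm f (powInv (k ℕ.+ j)) (invS f) m)
                       (trans (conv-congʳ (powInv (k ℕ.+ j)) f⁻¹-inverse m) (conv-identityʳ (powInv (k ℕ.+ j)) m))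

    ∂-inv : ∂ (invS f) ≋ -ˢ conv (invS f) (conv (∂ f) (invS f))
    ∂-inv n = begin
      ∂ (invS f) n                                 ≈⟨ sym (conv-identityˡ (∂ (invS f)) n) ⟩
      conv δ (∂ (invS f)) n
        ≈⟨ conv-congˡ (∂ (invS f)) (λ m → trans (sym (f⁻¹-inverse m)) (conv-comm f (invS f) m)) n ⟩
      conv (conv (invS f) f) (∂ (invS f)) n        ≈⟨ conv-assoc (invS f) f (∂ (invS f)) n ⟩
      conv (invS f) (conv f (∂ (invS f))) n        ≈⟨ conv-congʳ (invS f) f∂f⁻¹ n ⟩
      conv (invS f) (-ˢ conv (∂ f) (invS f)) n     ≈⟨ conv-negʳ (invS f) (conv (∂ f) (invS f)) n ⟩
      - conv (invS f) (conv (∂ f) (invS f)) n      ∎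
      where
      f∂f⁻¹ : conv f (∂ (invS f)) ≋ -ˢ conv (∂ f) (invS f)
      f∂f⁻¹ m = inverseʳ-unique _ _ (trans (sym (∂-conv f (invS f) m)) (f⁻¹-inverse (suc m)))

    V : ℕ → Seq
    V j = conv (∂ f) (powInv (suc j))

    ∂-powInv : ∀ j → ∂ (powInv j) ≋ -ˢ (fromℕ j ·ˢ V j)
    ∂-powInv zero    n = sym (trans (-‿cong (zeroˡ _)) ε⁻¹≈ε)
    ∂-powInv (suc j) n = begin
      ∂ (conv (powInv j) (invS f)) n
        ≈⟨ ∂-conv (powInv j) (invS f) n ⟩
      conv (∂ (powInv j)) (invS f) n + conv (powInv j) (∂ (invS f)) n
        ≈⟨ +-cong (conv-congˡ (invS f) (∂-powInv j) n) (conv-congʳ (powInv j) ∂-inv n) ⟩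
      conv (-ˢ (fromℕ j ·ˢ V j)) (invS f) n + conv (powInv j) (-ˢ conv (invS f) (conv (∂ f) (invS f))) n
        ≈⟨ +-cong (trans (conv-negˡ (fromℕ j ·ˢ V j) (invS f) n) (-‿cong (conv-scaleˡ (fromℕ j) (V j) (invS f) n)))
                  (conv-negʳ (powInv j) (conv (invS f) (conv (∂ f) (invS f))) n) ⟩
      - (fromℕ j * conv (V j) (invS f) n) + - conv (powInv j) (conv (invS f) (conv (∂ f) (invS f))) n
        ≈⟨ +-cong (-‿cong (*-congˡ (conv-assoc (∂ f) (powInv (suc j)) (invS f) n))) (-‿cong regroup) ⟩
      - (fromℕ j * Z) + - Z                        ≈⟨ -‿+-comm _ _ ⟩
      - (fromℕ j * Z + Z)                          ≈⟨ -‿cong (trans (+-comm _ _) (+-congʳ (sym (*-identityˡ Z)))) ⟩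
      - (1# * Z + fromℕ j * Z)                     ≈⟨ -‿cong (sym (distribʳ Z 1# (fromℕ j))) ⟩
      - (fromℕ (suc j) * Z)                        ∎
      where
      Z : Carrier
      Z = V (suc j) n
      regroup : conv (powInv j) (conv (invS f) (conv (∂ f) (invS f))) n ≈ Z
      regroup = trans (sym (conv-assoc (powInv j) (invS f) (conv (∂ f) (invS f)) n)) (conv-leftComm (powInv (suc j)) (∂ f) (invS f) n)

    -- (t f)′ f^{−j−1} = f^{−j} + t f′ f^{−j−1}
    Λ : ℕ → Seq
    Λ j = powInv j +ˢ conv (monomial 1) (V j)

    W : ℕ → Seq
    W k = conv (monomial k) (pow k)

    expand : Seq → Seq
    expand c n = ∑≤ n (λ k → c k * W k n)

    L : Seq → Seq
    L g n = conv g (Λ n) n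

    conv-W : ∀ k g n → conv (W k) g n ≈ fromℕ (n C k) * conv (pow k) g (n ∸ k)
    conv-W k g n = trans (conv-assoc (monomial k) (pow k) g n) (conv-monomial k (conv (pow k) g) n)

    W-vanishes-below : ∀ k i → i < k → W k i ≈ 0#
    W-vanishes-below k i i<k =
      conv-vanishes-below k 0 (monomial k) (pow k) (λ j j<k → monomial-offDiag k j (ℕ.<⇒≢ j<k)) (λ _ ())
                          i (≡.subst (i <_) (≡.sym (ℕ.+-identityʳ k)) i<k)

    conv-expand : ∀ c g n → conv (expand c) g n ≈ ∑≤ n (λ k → c k * conv (W k) g n)
    conv-expand c g n = begin
      conv (expand c) g n
        ≈⟨ conv-cong-≤ n {g = g} (λ i i≤n → sym (∑-truncate i n i≤n
              (λ k i<k _ → trans (*-congˡ (W-vanishes-below k i i<k)) (zeroʳ _)))) (λ _ _ → refl) ⟩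
      ∑≤ n (λ i → fromℕ (n C i) * (∑≤ n (λ k → c k * W k i) * g (n ∸ i)))
        ≈⟨ ∑-cong n (λ i _ → trans (*-congˡ (*-distribʳ-∑ n _ _)) (trans (*-distribˡ-∑ n _ _)
              (∑-cong n (λ k _ → trans (*-congˡ (*-assoc _ _ _)) (*-leftComm _ _ _))))) ⟩
      ∑≤ n (λ i → ∑≤ n (λ k → c k * (fromℕ (n C i) * (W k i * g (n ∸ i)))))
        ≈⟨ ∑-comm n n _ ⟩
      ∑≤ n (λ k → ∑≤ n (λ i → c k * (fromℕ (n C i) * (W k i * g (n ∸ i)))))
        ≈⟨ ∑-cong n (λ k _ → sym (*-distribˡ-∑ n (c k) _)) ⟩
      ∑≤ n (λ k → c k * conv (W k) g n) ∎

    Λ-at-0 : ∀ j → Λ j 0 ≈ 1#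
    Λ-at-0 j = trans (+-cong (powS-at-0 (invS f) j (*-identityˡ 1#)) t·V-at-0) (+-identityʳ 1#)
      where
      t·V-at-0 : conv (monomial 1) (V j) 0 ≈ 0#
      t·V-at-0 = trans (conv-monomial 1 (V j) 0) (fromℕ-C-zero {0} {1} (s≤s z≤n) (V j 0))

    -- For j > 0, (t f)′ f^{−j−1} = h − t h′/j with h = f^{−j}, whose tʲ-coefficient is zero.
    Λ-diag : ∀ j → Λ j j ≈ δ j
    Λ-diag zero    = Λ-at-0 0
    Λ-diag (suc m) = begin
      ∂ (powInv (suc m)) m + conv (monomial 1) (V (suc m)) (suc m)
        ≈⟨ +-cong (∂-powInv (suc m) m) (trans (conv-monomial 1 (V (suc m)) (suc m))
                     (*-congʳ (reflexive (≡.cong fromℕ (nC1≡n (suc m)))))) ⟩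
      - (fromℕ (suc m) * V (suc m) m) + fromℕ (suc m) * V (suc m) m ≈⟨ -‿inverseˡ _ ⟩
      0# ∎

    conv-pow-Λ : ∀ k j → conv (pow k) (Λ (k ℕ.+ j)) ≋ Λ j
    conv-pow-Λ k j n = begin
      conv (pow k) (Λ (k ℕ.+ j)) n
        ≈⟨ conv-distribˡ (pow k) (powInv (k ℕ.+ j)) (conv (monomial 1) (V (k ℕ.+ j))) n ⟩
      conv (pow k) (powInv (k ℕ.+ j)) n + conv (pow k) (conv (monomial 1) (V (k ℕ.+ j))) n
        ≈⟨ +-cong (conv-pow-powInv k j n)
                  (trans (conv-leftComm (pow k) (monomial 1) (V (k ℕ.+ j)) n)
                         (conv-congʳ (monomial 1) pow·V n)) ⟩
      Λ j n ∎
      where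
      reindex : powInv (suc (k ℕ.+ j)) ≋ powInv (k ℕ.+ suc j)
      reindex i = reflexive (≡.cong (λ t → powInv t i) (≡.sym (ℕ.+-suc k j)))
      pow·V : conv (pow k) (V (k ℕ.+ j)) ≋ V j
      pow·V m = trans (conv-leftComm (pow k) (∂ f) (powInv (suc (k ℕ.+ j))) m)
                      (conv-congʳ (∂ f) (λ i → trans (conv-congʳ (pow k) reindex i) (conv-pow-powInv k (suc j) i)) m)

    conv-W-Λ : ∀ k n → k ≤ n → conv (W k) (Λ n) n ≈ δ (n ∸ k)
    conv-W-Λ k n k≤n = ≡.subst (λ t → conv (W k) (Λ t) t ≈ δ (t ∸ k)) (ℕ.m+[n∸m]≡n k≤n) (begin
      conv (W k) (Λ (k ℕ.+ j)) (k ℕ.+ j)            ≈⟨ conv-W k (Λ (k ℕ.+ j)) (k ℕ.+ j) ⟩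
      fromℕ ((k ℕ.+ j) C k) * conv (pow k) (Λ (k ℕ.+ j)) (k ℕ.+ j ∸ k)
        ≈⟨ *-congˡ (trans (conv-pow-Λ k j _) (reflexive (≡.cong (Λ j) (ℕ.m+n∸m≡n k j)))) ⟩
      fromℕ ((k ℕ.+ j) C k) * Λ j j                  ≈⟨ *-congˡ (Λ-diag j) ⟩
      fromℕ ((k ℕ.+ j) C k) * δ j                    ≈⟨ binomial-δ j ⟩
      δ (k ℕ.+ j ∸ k)                              ∎)
      where
      j : ℕ
      j = n ∸ k
      binomial-δ : ∀ j → fromℕ ((k ℕ.+ j) C k) * δ j ≈ δ (k ℕ.+ j ∸ k)
      binomial-δ zero    = trans (*-identityʳ _)
        (trans (reflexive (≡.cong fromℕ (≡.trans (≡.cong (_C k) (ℕ.+-identityʳ k)) (nCn≡1 k))))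
               (trans fromℕ-1 (reflexive (≡.cong δ (≡.sym (ℕ.m+n∸m≡n k 0))))))
      binomial-δ (suc j) = trans (zeroʳ _) (reflexive (≡.cong δ (≡.sym (ℕ.m+n∸m≡n k (suc j)))))

    L-expand : ∀ c n → L (expand c) n ≈ c n
    L-expand c n = begin
      conv (expand c) (Λ n) n                    ≈⟨ conv-expand c (Λ n) n ⟩
      ∑≤ n (λ k → c k * conv (W k) (Λ n) n)      ≈⟨ ∑-single n n ℕ.≤-refl off-diagonal ⟩
      c n * conv (W n) (Λ n) n
        ≈⟨ *-congˡ (trans (conv-W-Λ n n ℕ.≤-refl) (reflexive (≡.cong δ (ℕ.n∸n≡0 n)))) ⟩
      c n * 1#                                   ≈⟨ *-identityʳ _ ⟩
      c n                                        ∎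
      where
      off-diagonal : ∀ k → k ≤ n → k ≢ n → c k * conv (W k) (Λ n) n ≈ 0#
      off-diagonal k k≤n k≢n with n ∸ k | ℕ.m<n⇒0<n∸m (ℕ.≤∧≢⇒< k≤n k≢n) | conv-W-Λ k n k≤n
      ... | suc _ | _ | W·Λ≈0 = trans (*-congˡ W·Λ≈0) (zeroʳ _)

    L-at-0 : ∀ g → L g 0 ≈ g 0
    L-at-0 g = trans (conv-at-0 g (Λ 0)) (trans (*-congˡ (Λ-at-0 0)) (*-identityʳ _))

    L-unfold : ∀ g m → L g (suc m) ≈ ∑≤ m (λ i → fromℕ (suc m C i) * (g i * Λ (suc m) (suc m ∸ i))) + g (suc m)
    L-unfold g m = +-congˡ (begin
      fromℕ (suc m C suc m) * (g (suc m) * Λ (suc m) (m ∸ m)) ≈⟨ *-congʳ (reflexive (≡.cong fromℕ (nCn≡1 (suc m)))) ⟩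
      fromℕ 1 * (g (suc m) * Λ (suc m) (m ∸ m))            ≈⟨ trans (*-congʳ fromℕ-1) (*-identityˡ _) ⟩
      g (suc m) * Λ (suc m) (m ∸ m)                         ≈⟨ *-congˡ (reflexive (≡.cong (Λ (suc m)) (ℕ.n∸n≡0 m))) ⟩
      g (suc m) * Λ (suc m) 0                               ≈⟨ trans (*-congˡ (Λ-at-0 (suc m))) (*-identityʳ _) ⟩
      g (suc m)                                             ∎)

    L-injective : ∀ g h → L g ≋ L h → g ≋ h
    L-injective g h Lg≈Lh = <-rec (λ n → g n ≈ h n) step
      where
      step : ∀ n → (∀ {i} → i < n → g i ≈ h i) → g n ≈ h n
      step zero    _     = trans (sym (L-at-0 g)) (trans (Lg≈Lh 0) (L-at-0 h))
      step (suc m) below = +-cancelˡ (begin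
        lower g + g (suc m) ≈⟨ sym (L-unfold g m) ⟩
        L g (suc m)         ≈⟨ Lg≈Lh (suc m) ⟩
        L h (suc m)         ≈⟨ L-unfold h m ⟩
        lower h + h (suc m) ≈⟨ +-congʳ (∑-cong m (λ i i≤m → *-congˡ (*-congʳ (sym (below (s≤s i≤m)))))) ⟩
        lower g + h (suc m) ∎)
        where
        lower : Seq → Carrier
        lower s = ∑≤ m (λ i → fromℕ (suc m C i) * (s i * Λ (suc m) (suc m ∸ i)))
        +-cancelˡ : ∀ {u v} → lower g + u ≈ lower g + v → u ≈ v
        +-cancelˡ = ∙-cancelˡ (lower g) _ _

    abel : Carrier → Seq
    abel y zero    = 1#
    abel y (suc m) = y * evalShift (powInv (suc m)) y m

    -- Since ∂(f^{−n}) = −n f′ f^{−n−1}, the two terms of (t f)′ f^{−n−1} telescope against e^{yt}.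
    L-exp : ∀ y → L (exp y) ≋ abel y
    L-exp y zero    = L-at-0 (exp y)
    L-exp y (suc m) = begin
      conv (exp y) (Λ (suc m)) (suc m)
        ≈⟨ conv-distribˡ (exp y) (powInv (suc m)) (conv (monomial 1) (V (suc m))) (suc m) ⟩
      conv (exp y) (powInv (suc m)) (suc m) + conv (exp y) (conv (monomial 1) (V (suc m))) (suc m)
        ≈⟨ +-cong (∂-conv (exp y) (powInv (suc m)) m) t·V-term ⟩
      (conv (y ·ˢ exp y) (powInv (suc m)) m + conv (exp y) (∂ (powInv (suc m))) m) + mV
        ≈⟨ +-congʳ (+-cong (conv-scaleˡ y (exp y) (powInv (suc m)) m) ∂-term) ⟩
      (y * conv (exp y) (powInv (suc m)) m + - mV) + mV
        ≈⟨ trans (+-assoc _ _ _) (trans (+-congˡ (-‿inverseˡ mV)) (+-identityʳ _)) ⟩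
      y * conv (exp y) (powInv (suc m)) m
        ≈⟨ *-congˡ (sym (evalShift≈conv-exp (powInv (suc m)) y m)) ⟩
      abel y (suc m) ∎
      where
      mV : Carrier
      mV = fromℕ (suc m) * conv (exp y) (V (suc m)) m
      t·V-term : conv (exp y) (conv (monomial 1) (V (suc m))) (suc m) ≈ mV
      t·V-term = trans (conv-leftComm (exp y) (monomial 1) (V (suc m)) (suc m))
                   (trans (conv-monomial 1 (conv (exp y) (V (suc m))) (suc m))
                          (*-congʳ (reflexive (≡.cong fromℕ (nC1≡n (suc m))))))
      ∂-term : conv (exp y) (∂ (powInv (suc m))) m ≈ - mV
      ∂-term = trans (conv-congʳ (exp y) (∂-powInv (suc m)) m)
                 (trans (conv-negʳ (exp y) (fromℕ (suc m) ·ˢ V (suc m)) m)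
                        (-‿cong (conv-scaleʳ (fromℕ (suc m)) (exp y) (V (suc m)) m)))

    expand-abel : ∀ y → expand (abel y) ≋ exp y
    expand-abel y = L-injective (expand (abel y)) (exp y) (λ n → trans (L-expand (abel y) n) (sym (L-exp y n)))

proposition7p2 : ∀ {c ℓ} (R : CommutativeRing c ℓ) → Umbral.IsChar0Domain R →
    (γ : Umbral.Umbra R) (x y : CommutativeRing.Carrier R) (n : ℕ) →
    CommutativeRing._≈_ R (Umbral._^ᴿ_ R (CommutativeRing._+_ R x y) n) (Umbral.rhs R γ x y n)
proposition7p2 R _ γ x y n = begin
  (x + y) ^ᴿ n                                 ≈⟨ sym (conv-exp-exp x y n) ⟩
  conv (exp y) (exp x) n                       ≈⟨ conv-congˡ (exp x) (λ i → sym (expand-abel y i)) n ⟩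
  conv (expand (abel y)) (exp x) n             ≈⟨ conv-expand (abel y) (exp x) n ⟩
  ∑≤ n (λ k → abel y k * conv (W k) (exp x) n) ≈⟨ ∑-cong n (λ k _ → sym (term≈ k)) ⟩
  rhs γ x y n                                  ∎
  where
  open CommutativeRing R
  open Umbral R
  open Sums R
  open PowerSeries R
  open Lagrange.Expansion R (moment γ) (moment-0 γ)
  open import Relation.Binary.Reasoning.Setoid setoid
  open import Algebra.Properties.CommutativeSemigroup *-commutativeSemigroup using (x∙yz≈y∙xz)

  yFactor≡abel : ∀ k → yFactor γ y k ≡ abel y k
  yFactor≡abel zero    = ≡.refl
  yFactor≡abel (suc k) = ≡.refl

  term≈ : ∀ k → term γ x y n k ≈ abel y k * conv (W k) (exp x) n
  term≈ k = begin
    fromℕ (n C k) * (yFactor γ y k * evalShift (pow k) x (n ∸ k))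
      ≈⟨ *-congˡ (*-cong (reflexive (yFactor≡abel k))
                         (trans (evalShift≈conv-exp (pow k) x (n ∸ k)) (conv-comm (exp x) (pow k) (n ∸ k)))) ⟩
    fromℕ (n C k) * (abel y k * conv (pow k) (exp x) (n ∸ k)) ≈⟨ x∙yz≈y∙xz _ _ _ ⟩
    abel y k * (fromℕ (n C k) * conv (pow k) (exp x) (n ∸ k)) ≈⟨ *-congˡ (sym (conv-W k (exp x) n)) ⟩
    abel y k * conv (W k) (exp x) n                           ∎
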